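{- Let $n\ge1$, let $\mathcal{B}$ be a non-trivial Boolean algebra and let $\nu\in\mathcal{F}^{\mathcal{B}}_{C_n}$. For a formula $\alpha$ write ${\sim}\alpha:=\neg\alpha\wedge\alpha^{(n)}$. Then for every formula $\alpha$: (1) $\nu(\alpha\wedge{\sim}\alpha)=F_n$, where $F_n=(0,1,1,\dots,1)\in|\mathcal{B}|^{n+1}$; (2) $\nu(\alpha\vee{\sim}\alpha)\in D^{\mathcal{B}}_n$.
   Context: $\Sigma$ is the signature with unary $\neg$ and binary $\wedge,\vee,\to$; formulas are built from countably many variables. For a formula $\alpha$: $\alpha^0=\alpha$, $\alpha^{k+1}=\neg(\alpha^k\wedge\neg(\alpha^k))$; $\alpha^{(1)}=\alpha^1$, $\alpha^{(k+1)}=\alpha^{(k)}\wedge\alpha^{k+1}$. For a non-trivial Boolean algebra $\mathcal{B}$ (complement $\sim$, $a\to b=\sim a\vee b$) and $z\in|\mathcal{B}|^{n+1}$ with coordinates $z_{[i]}$: $B^{\mathcal{B}}_n=\{z: (\bigwedge_{i=1}^k z_{[i]})\vee z_{[k+1]}=1 \ \forall 1\le k\le n\}$, $D^{\mathcal{B}}_n=\{z\in B^{\mathcal{B}}_n:z_{[1]}=1\}$, $Boo^{\mathcal{B}}_n=\{z\in B^{\mathcal{B}}_n:z_{[1]}\wedge z_{[2]}=0\}$. Multioperations on $B^{\mathcal{B}}_n$: $\tilde\neg z=\{w\in B^{\mathcal{B}}_n: w_{[1]}=z_{[2]}, w_{[2]}\le z_{[1]}\}$; for $\#\in\{\wedge,\vee,\to\}$,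 $z\tilde\# w=\{u\in Boo^{\mathcal{B}}_n:u_{[1]}=z_{[1]}\#w_{[1]}\}$ if $z,w\in Boo^{\mathcal{B}}_n$, else $\{u\in B^{\mathcal{B}}_n:u_{[1]}=z_{[1]}\#w_{[1]}\}$. A valuation is a map $\nu$ from formulas to $B^{\mathcal{B}}_n$ with $\nu(\neg\alpha)\in\tilde\neg\nu(\alpha)$, $\nu(\alpha\#\beta)\in\nu(\alpha)\tilde\#\nu(\beta)$. $\mathcal{F}^{\mathcal{B}}_{C_n}$ is the set of valuations such that for all $\alpha,\beta$: (1) $\nu(\alpha\wedge\neg\alpha)_{[2]}=\nu(\alpha)_{[3]}$; (2) $\nu(\alpha^1)=(\nu(\alpha)_{[3]},\nu(\alpha)_{[1]}\wedge\nu(\alpha)_{[2]},\nu(\alpha)_{[4]},\dots,\nu(\alpha)_{[n+1]},\sim\bigwedge_{i=1}^{n+1}\nu(\alpha)_{[i]})$ (for $n=1$ read $\nu(\alpha)_{[3]}$ as $\sim(\nu(\alpha)_{[1]}\wedge\nu(\alpha)_{[2]})$ and (2) as $\nu(\alpha^1)=(\sim(\nu(\alpha)_{[1]}\wedge\nu(\alpha)_{[2]}),\nu(\alpha)_{[1]}\wedge\nu(\alpha)_{[2]})$); (3) $\nu((\alpha^{(n)}\wedge\beta^{(n)})\to(\alpha\#\beta)^{(n)})\in D^{\mathcal{B}}_n$ for $\#\in\{\wedge,\vee,\to\}$. -}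

module Defs where

open import Level using (_⊔_)
open import Data.Nat using (ℕ; zero; suc)
open import Data.Fin using (Fin; zero; suc; inject₁; fromℕ)
open import Data.Product using (_×_; Σ)
open import Algebra.Lattice.Bundles using (BooleanAlgebra)
import Relation.Nullary as N

infixr 7 _∧ᶠ_
infixr 6 _∨ᶠ_
infixr 5 _⇒ᶠ_

data Formula : Set where
  var   : ℕ → Formula
  ¬ᶠ_   : Formula → Formula
  _∧ᶠ_  : Formula → Formula → Formula
  _∨ᶠ_  : Formula → Formula → Formula
  _⇒ᶠ_  : Formula → Formula → Formula

pow : Formula → ℕ → Formula
pow α zero    = α
pow α (suc k) = ¬ᶠ (pow α k ∧ᶠ ¬ᶠ (pow α k))

-- α^(k) for k ≥ 1, indexed by m with k = suc m:
-- α^(1) = α^1,  α^(k+1) = α^(k) ∧ α^{k+1}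
cpow : Formula → ℕ → Formula
cpow α zero    = pow α 1
cpow α (suc m) = cpow α m ∧ᶠ pow α (suc (suc m))

data BinOp : Set where
  opAnd opOr opImp : BinOp

applyᶠ : BinOp → Formula → Formula → Formula
applyᶠ opAnd α β = α ∧ᶠ β
applyᶠ opOr  α β = α ∨ᶠ β
applyᶠ opImp α β = α ⇒ᶠ β

-- Semantics in a Boolean algebra 𝔹.  Tuples in |𝔹|^{n+1} are functions
-- Fin (suc n) → Carrier; coordinate z_[i] (1-based) is  z (i-1).

module _ {c ℓ} (𝔹 : BooleanAlgebra c ℓ) where
  open BooleanAlgebra 𝔹

  NonTrivial : Set ℓ
  NonTrivial = N.¬ (⊤ ≈ ⊥)

  _⇒_ : Carrier → Carrier → Carrier
  a ⇒ b = (¬ a) ∨ b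

  _≤_ : Carrier → Carrier → Set ℓ
  a ≤ b = (a ∧ b) ≈ a

  applyᴮ : BinOp → Carrier → Carrier → Carrier
  applyᴮ opAnd a b = a ∧ b
  applyᴮ opOr  a b = a ∨ b
  applyᴮ opImp a b = a ⇒ b

  Tuple : ℕ → Set c
  Tuple n = Fin (suc n) → Carrier

  prefixMeet : ∀ {n} → Tuple n → Fin (suc n) → Carrier
  prefixMeet z zero = z zero
  prefixMeet {suc n} z (suc i) = z zero ∧ prefixMeet (λ j → z (suc j)) i

  meetAll : ∀ {n} → Tuple n → Carrier
  meetAll {n} z = prefixMeet z (fromℕ n)

  -- B_n : (⋀_{i=1}^k z_[i]) ∨ z_[k+1] = 1 for all 1 ≤ k ≤ n   (k = i+1, i : Fin n)
  InB : ∀ n → Tuple n → Set ℓ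
  InB n z = (i : Fin n) → (prefixMeet z (inject₁ i) ∨ z (suc i)) ≈ ⊤

  InD : ∀ n → Tuple n → Set ℓ
  InD n z = InB n z × (z zero ≈ ⊤)

  InBoo : ∀ m → Tuple (suc m) → Set ℓ
  InBoo m z = InB (suc m) z × ((z zero ∧ z (suc zero)) ≈ ⊥)

  _≋_ : ∀ {n} → Tuple n → Tuple n → Set ℓ
  z ≋ w = ∀ i → z i ≈ w i

  Fn : ∀ n → Tuple n
  Fn n zero    = ⊥
  Fn n (suc i) = ⊤

  -- Below, n = suc m (so n ≥ 1).

  -- "ν(α)_[3]", with the convention ν(α)_[3] := ∼(ν(α)_[1] ∧ ν(α)_[2]) when n = 1
  third : ∀ m → Tuple (suc m) → Carrier
  third zero    z = ¬ (z zero ∧ z (suc zero))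
  third (suc k) z = z (suc (suc zero))

  snocT : ∀ k → (Fin k → Carrier) → Carrier → Fin (suc k) → Carrier
  snocT zero    w x zero    = x
  snocT (suc k) w x zero    = w zero
  snocT (suc k) w x (suc i) = snocT k (λ j → w (suc j)) x i

  -- the tuple prescribed for ν(α^1) in condition (2):
  -- n ≥ 2: (z_[3], z_[1]∧z_[2], z_[4], …, z_[n+1], ∼⋀_{i=1}^{n+1} z_[i])
  -- n = 1: (∼(z_[1]∧z_[2]), z_[1]∧z_[2])
  oneTuple : ∀ m → Tuple (suc m) → Tuple (suc m)
  oneTuple m z zero = third m z
  oneTuple m z (suc zero) = z zero ∧ z (suc zero)
  oneTuple (suc k) z (suc (suc i)) =
    snocT k (λ j → z (suc (suc (suc j)))) (¬ (meetAll z)) i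

  -- valuations: ν(¬α) ∈ ~¬ ν(α),  ν(α#β) ∈ ν(α) ~# ν(β)
  -- ν(¬α) ∈ ~¬ z  iff  ν(¬α) ∈ B_n, ν(¬α)_[1] = z_[2], ν(¬α)_[2] ≤ z_[1]
  NegCond : ∀ m → Tuple (suc m) → Tuple (suc m) → Set ℓ
  NegCond m z w = InB (suc m) w × (w zero ≈ z (suc zero)) × (w (suc zero) ≤ z zero)

  -- u ∈ z ~# w : u ∈ B_n, u_[1] = z_[1] # w_[1], and if z,w ∈ Boo_n then u ∈ Boo_n
  BinCond : ∀ m → BinOp → Tuple (suc m) → Tuple (suc m) → Tuple (suc m) → Set ℓ
  BinCond m o z w u =
    InB (suc m) u × (u zero ≈ applyᴮ o (z zero) (w zero)) ×
    (InBoo m z → InBoo m w → InBoo m u)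

  record IsValuation (m : ℕ) (ν : Formula → Tuple (suc m)) : Set ℓ where
    field
      inB   : ∀ α → InB (suc m) (ν α)
      neg   : ∀ α → NegCond m (ν α) (ν (¬ᶠ α))
      bin   : ∀ o α β → BinCond m o (ν α) (ν β) (ν (applyᶠ o α β))

  record InFCn (m : ℕ) (ν : Formula → Tuple (suc m)) : Set (c ⊔ ℓ) where
    field
      valuation : IsValuation m ν
      cond1 : ∀ α → ν (α ∧ᶠ ¬ᶠ α) (suc zero) ≈ third m (ν α)
      cond2 : ∀ α → ν (pow α 1) ≋ oneTuple m (ν α)
      cond3 : ∀ o α β →
        InD (suc m) (ν ((cpow α m ∧ᶠ cpow β m) ⇒ᶠ cpow (applyᶠ o α β) m))

strongNeg : ℕ → Formula → Formula
strongNeg m α = (¬ᶠ α) ∧ᶠ cpow α m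

-- Write w r = ν(α^r). Condition (2) makes w (r+1) start with (w r)₃ and (w r)₁ ∧ (w r)₂ and
-- shift the remaining coordinates down, appending ∼⋀ w r. Hence for k ≥ 2 the meet of the
-- first k coordinates of w (r+1) is the meet of the first k + 1 of w r, while the meet of all
-- n + 1 coordinates of w 1 is ⋀ w 0 ∧ ∼⋀ w 0 = 0; iterating, (w n)₁ ∧ (w n)₂ = 0. The first
-- coordinate of α ∧ ∼α is (w 0)₁ ∧ (w 0)₂ ∧ (w 1)₁ ∧ … ∧ (w n)₁ = (w n)₁ ∧ (w n)₂ = 0, and
-- membership in B_n forces the other coordinates to be 1. For α ∨ ∼α: B_n gives
-- ((w r)₁ ∧ (w r)₂) ∨ (w (r+1))₁ = 1, and (w r)₁ ∧ (w r)₂ decreases in r, so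
-- ((w 0)₁ ∧ (w 0)₂) ∨ ((w 1)₁ ∧ … ∧ (w n)₁) = 1; with (w 0)₁ ∨ (w 0)₂ = 1 this makes the
-- first coordinate 1.
module Submission where

open import Defs
open import Data.Nat using (ℕ; zero; suc; _+_; s≤s)
import Data.Nat as ℕ
open import Data.Nat.Properties using (+-suc; +-identityʳ; m≤n+m)
open import Data.Fin using (Fin; zero; suc; inject₁)
open import Data.Product using (_×_; _,_; proj₁; proj₂)
open import Algebra.Bundles using (CommutativeSemigroup)
open import Algebra.Lattice.Bundles using (BooleanAlgebra)
open import Algebra.Structures using (module IsCommutativeBand)
import Algebra.Lattice.Properties.BooleanAlgebra as BooleanAlgebraProperties
import Algebra.Properties.CommutativeSemigroup as CommutativeSemigroupProperties
import Relation.Binary.PropositionalEquality as ≡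
open ≡ using (_≡_)
import Relation.Binary.Reasoning.Setoid as SetoidReasoning

module _ {c ℓ} (𝔹 : BooleanAlgebra c ℓ) where
  open BooleanAlgebra 𝔹
  open BooleanAlgebraProperties 𝔹
  open SetoidReasoning setoid

  ∧-commutativeSemigroup : CommutativeSemigroup c ℓ
  ∧-commutativeSemigroup = record
    { isCommutativeSemigroup = IsCommutativeBand.isCommutativeSemigroup ∧-isSemilattice }

  open CommutativeSemigroupProperties ∧-commutativeSemigroup using (x∙yz≈y∙xz)

  ∧-rotate : ∀ d a b r → d ∧ ((a ∧ b) ∧ r) ≈ a ∧ (b ∧ (d ∧ r))
  ∧-rotate d a b r = trans (x∙yz≈y∙xz d (a ∧ b) r) (∧-assoc a b (d ∧ r))

  -- Counting past the last coordinate is harmless: the missing ones count as ⊤.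
  ⋀ : ∀ {k} → ℕ → (Fin k → Carrier) → Carrier
  ⋀ zero    f = ⊤
  ⋀ {zero}  (suc j) f = ⊤
  ⋀ {suc k} (suc j) f = f zero ∧ ⋀ j (λ i → f (suc i))

  ⋀-cong : ∀ {k} j {f g : Fin k → Carrier} → (∀ i → f i ≈ g i) → ⋀ j f ≈ ⋀ j g
  ⋀-cong zero            f≈g = refl
  ⋀-cong {zero}  (suc j) f≈g = refl
  ⋀-cong {suc k} (suc j) f≈g = ∧-cong (f≈g zero) (⋀-cong j (λ i → f≈g (suc i)))

  ⋀-snocT : ∀ k f x → ⋀ (suc k) (snocT 𝔹 k f x) ≈ ⋀ k f ∧ x
  ⋀-snocT zero    f x = ∧-comm x ⊤
  ⋀-snocT (suc k) f x = begin
    f zero ∧ ⋀ (suc k) (snocT 𝔹 k (λ i → f (suc i)) x) ≈⟨ ∧-congˡ (⋀-snocT k _ x) ⟩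
    f zero ∧ (⋀ k (λ i → f (suc i)) ∧ x)              ≈⟨ ∧-assoc _ _ x ⟨
    (f zero ∧ ⋀ k (λ i → f (suc i))) ∧ x              ∎

  ⋀-snocT-≤ : ∀ k f x {j} → j ℕ.≤ k → ⋀ j (snocT 𝔹 k f x) ≈ ⋀ j f
  ⋀-snocT-≤ k       f x {zero}  _         = refl
  ⋀-snocT-≤ (suc k) f x {suc j} (s≤s j≤k) = ∧-congˡ (⋀-snocT-≤ k (λ i → f (suc i)) x j≤k)

  meetAll≈⋀ : ∀ {n} (z : Tuple 𝔹 n) → meetAll 𝔹 z ≈ ⋀ (suc n) z
  meetAll≈⋀ {zero}  z = sym (∧-identityʳ (z zero))
  meetAll≈⋀ {suc n} z = ∧-congˡ (meetAll≈⋀ (λ i → z (suc i)))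

  ⋀-oneTuple : ∀ {m} (w : Tuple 𝔹 (suc m)) {j} → suc j ℕ.≤ m →
    ⋀ (2 + j) (oneTuple 𝔹 m w) ≈ ⋀ (3 + j) w
  ⋀-oneTuple {suc k} w {j} (s≤s j≤k) = begin
    w₂ ∧ ((w₀ ∧ w₁) ∧ ⋀ j (snocT 𝔹 k f x)) ≈⟨ ∧-congˡ (∧-congˡ (⋀-snocT-≤ k f x j≤k)) ⟩
    w₂ ∧ ((w₀ ∧ w₁) ∧ ⋀ j f)               ≈⟨ ∧-rotate w₂ w₀ w₁ (⋀ j f) ⟩
    w₀ ∧ (w₁ ∧ (w₂ ∧ ⋀ j f))               ∎
    where
    w₀ w₁ w₂ x : Carrier
    w₀ = w zero
    w₁ = w (suc zero)
    w₂ = w (suc (suc zero))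
    x  = ¬ meetAll 𝔹 w
    f : Fin k → Carrier
    f i = w (suc (suc (suc i)))

  ⋀-oneTuple-all : ∀ m (w : Tuple 𝔹 (suc m)) → ⋀ (2 + m) (oneTuple 𝔹 m w) ≈ ⊥
  ⋀-oneTuple-all zero w = begin
    ¬ (w zero ∧ w (suc zero)) ∧ ((w zero ∧ w (suc zero)) ∧ ⊤)
      ≈⟨ ∧-congˡ (∧-identityʳ _) ⟩
    ¬ (w zero ∧ w (suc zero)) ∧ (w zero ∧ w (suc zero))
      ≈⟨ ∧-complementˡ _ ⟩
    ⊥ ∎
  ⋀-oneTuple-all (suc k) w = begin
    w₂ ∧ ((w₀ ∧ w₁) ∧ ⋀ (suc k) (snocT 𝔹 k f x)) ≈⟨ ∧-congˡ (∧-congˡ (⋀-snocT k f x)) ⟩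
    w₂ ∧ ((w₀ ∧ w₁) ∧ (⋀ k f ∧ x))              ≈⟨ ∧-congˡ (∧-assoc _ _ x) ⟨
    w₂ ∧ (((w₀ ∧ w₁) ∧ ⋀ k f) ∧ x)              ≈⟨ ∧-assoc w₂ _ x ⟨
    (w₂ ∧ ((w₀ ∧ w₁) ∧ ⋀ k f)) ∧ x              ≈⟨ ∧-congʳ (∧-rotate w₂ w₀ w₁ (⋀ k f)) ⟩
    ⋀ (3 + k) w ∧ ¬ meetAll 𝔹 w                  ≈⟨ ∧-congˡ (¬-cong (meetAll≈⋀ w)) ⟩
    ⋀ (3 + k) w ∧ ¬ ⋀ (3 + k) w                  ≈⟨ ∧-complementʳ _ ⟩
    ⊥                                            ∎
    where
    w₀ w₁ w₂ x : Carrier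
    w₀ = w zero
    w₁ = w (suc zero)
    w₂ = w (suc (suc zero))
    x  = ¬ meetAll 𝔹 w
    f : Fin k → Carrier
    f i = w (suc (suc (suc i)))

  meet₁₂ : ∀ {n} → Tuple 𝔹 (suc n) → Carrier
  meet₁₂ u = u zero ∧ u (suc zero)

  meet₁₂∨third≈⊤ : ∀ m (u : Tuple 𝔹 (suc m)) → InB 𝔹 (suc m) u → meet₁₂ u ∨ third 𝔹 m u ≈ ⊤
  meet₁₂∨third≈⊤ zero    u _   = ∨-complementʳ (meet₁₂ u)
  meet₁₂∨third≈⊤ (suc k) u u∈B = u∈B (suc zero)

  prefixMeet-⊥ : ∀ {n} (u : Tuple 𝔹 n) i → u zero ≈ ⊥ → prefixMeet 𝔹 u i ≈ ⊥
  prefixMeet-⊥         u zero    u₀≈⊥ = u₀≈⊥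
  prefixMeet-⊥ {suc n} u (suc i) u₀≈⊥ = trans (∧-congʳ u₀≈⊥) (∧-zeroˡ _)

  InB⇒≋Fn : ∀ n (u : Tuple 𝔹 n) → InB 𝔹 n u → u zero ≈ ⊥ → _≋_ 𝔹 u (Fn 𝔹 n)
  InB⇒≋Fn n u u∈B u₀≈⊥ zero    = u₀≈⊥
  InB⇒≋Fn n u u∈B u₀≈⊥ (suc i) = begin
    u (suc i)                              ≈⟨ ∨-identityˡ _ ⟨
    ⊥ ∨ u (suc i)                          ≈⟨ ∨-congʳ (prefixMeet-⊥ u (inject₁ i) u₀≈⊥) ⟨
    prefixMeet 𝔹 u (inject₁ i) ∨ u (suc i) ≈⟨ u∈B i ⟩
    ⊤                                      ∎

  module Orbit {m} (w : ℕ → Tuple 𝔹 (suc m))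
               (w-step : ∀ r → _≋_ 𝔹 (w (suc r)) (oneTuple 𝔹 m (w r))) where

    meet₁₂-step : ∀ r → meet₁₂ (w (suc r)) ≈ w (suc r) zero ∧ meet₁₂ (w r)
    meet₁₂-step r = ∧-congˡ (w-step r (suc zero))

    ⋀-orbit-⊥ : ∀ i j → i + j ≡ m → ⋀ (2 + j) (w (suc i)) ≈ ⊥
    ⋀-orbit-⊥ zero    j ≡.refl = trans (⋀-cong (2 + j) (w-step 0)) (⋀-oneTuple-all j (w 0))
    ⋀-orbit-⊥ (suc i) j i+j≡m = begin
      ⋀ (2 + j) (w (2 + i))                ≈⟨ ⋀-cong (2 + j) (w-step (suc i)) ⟩
      ⋀ (2 + j) (oneTuple 𝔹 m (w (suc i))) ≈⟨ ⋀-oneTuple (w (suc i)) (≡.subst (suc j ℕ.≤_) i+j≡m (s≤s (m≤n+m j i))) ⟩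
      ⋀ (3 + j) (w (suc i))                ≈⟨ ⋀-orbit-⊥ i (suc j) (≡.trans (+-suc i j) i+j≡m) ⟩
      ⊥                                    ∎

    meet₁₂-orbit-⊥ : meet₁₂ (w (suc m)) ≈ ⊥
    meet₁₂-orbit-⊥ = trans (∧-congˡ (sym (∧-identityʳ _))) (⋀-orbit-⊥ m 0 (+-identityʳ m))

    headMeet : ℕ → Carrier
    headMeet zero    = w 1 zero
    headMeet (suc j) = headMeet j ∧ w (2 + j) zero

    meet₁₂∧headMeet : ∀ j → meet₁₂ (w 0) ∧ headMeet j ≈ meet₁₂ (w (suc j))
    meet₁₂∧headMeet zero    = trans (∧-comm _ _) (sym (meet₁₂-step 0))
    meet₁₂∧headMeet (suc j) = begin
      meet₁₂ (w 0) ∧ (headMeet j ∧ a)   ≈⟨ ∧-assoc _ _ a ⟨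
      (meet₁₂ (w 0) ∧ headMeet j) ∧ a   ≈⟨ ∧-congʳ (meet₁₂∧headMeet j) ⟩
      meet₁₂ (w (suc j)) ∧ a            ≈⟨ ∧-comm _ a ⟩
      a ∧ meet₁₂ (w (suc j))            ≈⟨ meet₁₂-step (suc j) ⟨
      meet₁₂ (w (2 + j))                ∎
      where
      a : Carrier
      a = w (2 + j) zero

    meet₁₂-antitone : ∀ r → meet₁₂ (w 0) ∨ meet₁₂ (w r) ≈ meet₁₂ (w 0)
    meet₁₂-antitone zero    = ∨-idem _
    meet₁₂-antitone (suc r) = begin
      h₀ ∨ meet₁₂ (w (suc r))           ≈⟨ ∨-congˡ (meet₁₂-step r) ⟩
      h₀ ∨ (a ∧ meet₁₂ (w r))           ≈⟨ ∨-distribˡ-∧ h₀ a _ ⟩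
      (h₀ ∨ a) ∧ (h₀ ∨ meet₁₂ (w r))    ≈⟨ ∧-congˡ (meet₁₂-antitone r) ⟩
      (h₀ ∨ a) ∧ h₀                     ≈⟨ ∧-comm _ h₀ ⟩
      h₀ ∧ (h₀ ∨ a)                     ≈⟨ ∧-absorbs-∨ h₀ a ⟩
      h₀                                ∎
      where
      h₀ a : Carrier
      h₀ = meet₁₂ (w 0)
      a  = w (suc r) zero

    module _ (w∈B : ∀ r → InB 𝔹 (suc m) (w r)) where

      meet₁₂∨head≈⊤ : ∀ r → meet₁₂ (w 0) ∨ w (suc r) zero ≈ ⊤
      meet₁₂∨head≈⊤ r = begin
        h₀ ∨ w (suc r) zero                     ≈⟨ ∨-congʳ (meet₁₂-antitone r) ⟨
        (h₀ ∨ meet₁₂ (w r)) ∨ w (suc r) zero    ≈⟨ ∨-assoc h₀ _ _ ⟩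
        h₀ ∨ (meet₁₂ (w r) ∨ w (suc r) zero)    ≈⟨ ∨-congˡ (∨-congˡ (w-step r zero)) ⟩
        h₀ ∨ (meet₁₂ (w r) ∨ third 𝔹 m (w r))   ≈⟨ ∨-congˡ (meet₁₂∨third≈⊤ m (w r) (w∈B r)) ⟩
        h₀ ∨ ⊤                                  ≈⟨ ∨-zeroʳ h₀ ⟩
        ⊤                                       ∎
        where
        h₀ : Carrier
        h₀ = meet₁₂ (w 0)

      meet₁₂∨headMeet≈⊤ : ∀ j → meet₁₂ (w 0) ∨ headMeet j ≈ ⊤
      meet₁₂∨headMeet≈⊤ zero    = meet₁₂∨head≈⊤ 0
      meet₁₂∨headMeet≈⊤ (suc j) = begin
        h₀ ∨ (headMeet j ∧ w (2 + j) zero)         ≈⟨ ∨-distribˡ-∧ h₀ _ _ ⟩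
        (h₀ ∨ headMeet j) ∧ (h₀ ∨ w (2 + j) zero)  ≈⟨ ∧-cong (meet₁₂∨headMeet≈⊤ j) (meet₁₂∨head≈⊤ (suc j)) ⟩
        ⊤ ∧ ⊤                                      ≈⟨ ∧-idem ⊤ ⟩
        ⊤                                          ∎
        where
        h₀ : Carrier
        h₀ = meet₁₂ (w 0)

  module _ {m} {ν : Formula → Tuple 𝔹 (suc m)} (ν∈F : InFCn 𝔹 m ν) (α : Formula) where
    open InFCn ν∈F
    open IsValuation valuation
    open Orbit (λ r → ν (pow α r)) (λ r → cond2 (pow α r))

    head-∧ᶠ : ∀ β γ → ν (β ∧ᶠ γ) zero ≈ ν β zero ∧ ν γ zero
    head-∧ᶠ β γ = proj₁ (proj₂ (bin opAnd β γ))

    head-∨ᶠ : ∀ β γ → ν (β ∨ᶠ γ) zero ≈ ν β zero ∨ ν γ zero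
    head-∨ᶠ β γ = proj₁ (proj₂ (bin opOr β γ))

    head-cpow : ∀ j → ν (cpow α j) zero ≈ headMeet j
    head-cpow zero    = refl
    head-cpow (suc j) = trans (head-∧ᶠ (cpow α j) _) (∧-congʳ (head-cpow j))

    head-strongNeg : ν (strongNeg m α) zero ≈ ν α (suc zero) ∧ headMeet m
    head-strongNeg = trans (head-∧ᶠ (¬ᶠ α) (cpow α m)) (∧-cong (proj₁ (proj₂ (neg α))) (head-cpow m))

    head-∧ᶠ-strongNeg : ν (α ∧ᶠ strongNeg m α) zero ≈ ⊥
    head-∧ᶠ-strongNeg = begin
      ν (α ∧ᶠ strongNeg m α) zero              ≈⟨ head-∧ᶠ α _ ⟩
      ν α zero ∧ ν (strongNeg m α) zero        ≈⟨ ∧-congˡ head-strongNeg ⟩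
      ν α zero ∧ (ν α (suc zero) ∧ headMeet m) ≈⟨ ∧-assoc _ _ _ ⟨
      meet₁₂ (ν α) ∧ headMeet m                ≈⟨ meet₁₂∧headMeet m ⟩
      meet₁₂ (ν (pow α (suc m)))               ≈⟨ meet₁₂-orbit-⊥ ⟩
      ⊥                                        ∎

    head-∨ᶠ-strongNeg : ν (α ∨ᶠ strongNeg m α) zero ≈ ⊤
    head-∨ᶠ-strongNeg = begin
      ν (α ∨ᶠ strongNeg m α) zero                          ≈⟨ head-∨ᶠ α _ ⟩
      a₁ ∨ ν (strongNeg m α) zero                          ≈⟨ ∨-congˡ head-strongNeg ⟩
      a₁ ∨ (a₂ ∧ headMeet m)                               ≈⟨ ∨-distribˡ-∧ a₁ a₂ _ ⟩
      (a₁ ∨ a₂) ∧ (a₁ ∨ headMeet m)                        ≈⟨ ∧-congˡ (∨-congʳ (∨-absorbs-∧ a₁ a₂)) ⟨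
      (a₁ ∨ a₂) ∧ ((a₁ ∨ meet₁₂ (ν α)) ∨ headMeet m)       ≈⟨ ∧-congˡ (∨-assoc a₁ _ _) ⟩
      (a₁ ∨ a₂) ∧ (a₁ ∨ (meet₁₂ (ν α) ∨ headMeet m))       ≈⟨ ∧-cong (inB α zero) (∨-congˡ (meet₁₂∨headMeet≈⊤ (λ r → inB (pow α r)) m)) ⟩
      ⊤ ∧ (a₁ ∨ ⊤)                                         ≈⟨ ∧-congˡ (∨-zeroʳ a₁) ⟩
      ⊤ ∧ ⊤                                                ≈⟨ ∧-idem ⊤ ⟩
      ⊤                                                    ∎
      where
      a₁ a₂ : Carrier
      a₁ = ν α zero
      a₂ = ν α (suc zero)

proposition4p8 : ∀ {c ℓ} (𝔹 : BooleanAlgebra c ℓ) → NonTrivial 𝔹 →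
    (m : ℕ) (ν : Formula → Tuple 𝔹 (suc m)) → InFCn 𝔹 m ν →
    (α : Formula) →
    _≋_ 𝔹 (ν (α ∧ᶠ strongNeg m α)) (Fn 𝔹 (suc m)) ×
    InD 𝔹 (suc m) (ν (α ∨ᶠ strongNeg m α))
proposition4p8 𝔹 _ m ν ν∈F α =
  InB⇒≋Fn 𝔹 (suc m) _ (inB (α ∧ᶠ strongNeg m α)) (head-∧ᶠ-strongNeg 𝔹 ν∈F α) ,
  (inB (α ∨ᶠ strongNeg m α) , head-∨ᶠ-strongNeg 𝔹 ν∈F α)
  where open IsValuation (InFCn.valuation ν∈F)
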